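{- Let $n,k,t,r,s$ be positive integers with $1\leq r\leq k$. Let $\overline{p}(n,k,t,r,s)$ be the number of $k$-tuples $(\alpha^1,\ldots,\alpha^k)$ of strict overpartitions with $|\alpha^1|+\cdots+|\alpha^k|=n$ and exactly $s$ overlined parts in total, such that $\alpha^1,\ldots,\alpha^r$ each have length $t$, $\alpha^{r+1},\ldots,\alpha^k$ each have length $t-1$, and for every $i\neq r$ each overlined part of $\alpha^i$ is at least $2$. Let $\overline{q}(n,k,t,r,s)$ be the number of Schmidt $k$-overpartitions of $n$ with exactly $(t-1)k+r$ parts, exactly $s$ of which are overlined. Then $\overline{p}(n,k,t,r,s)=\overline{q}(n,k,t,r,s)$.
   Context: An overpartition is a partition (finite weakly decreasing sequence of positive integers) in which the final occurrence of each part value may be overlined; its length is the number of parts and $|\cdot|$ the sum of parts. A strict overpartition is an overpartition $(\lambda_1,\ldots,\lambda_l)$ with $\lambda_1>\lambda_2>\cdots>\lambda_l$ in which a part $\lambda_i$ may be overlined only if $\lambda_i-\lambda_{i+1}\geq 2$ or $\lambda_i=\lambda_l$ (i.e. it is the last part). A Schmidt $k$-overpartition of $n$ is a strict overpartition $(\lambda_1,\lambda_2,\ldots)$ with $\lambda_1+\lambda_{k+1}+\lambda_{2k+1}+\cdots=n$. -}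

module Defs where

open import Data.Nat using (ℕ; zero; suc; _+_; _∸_; _≤ᵇ_; _<ᵇ_; _≡ᵇ_)
open import Data.Bool using (Bool; true; false; _∧_; _∨_; not; if_then_else_; T)
open import Data.Product using (_×_; _,_; proj₁; proj₂; Σ)
open import Data.List using (List; []; _∷_; length)
open import Data.Vec using (Vec; []; _∷_)

-- A part of an overpartition: (value , overlined?)
Part : Set
Part = ℕ × Bool

-- An overpartition is represented as a list of parts in the order λ₁, λ₂, …, λₗ.

isStrictOP : List Part → Bool
isStrictOP [] = true
isStrictOP ((a , o) ∷ []) = 1 ≤ᵇ a
isStrictOP ((a , o) ∷ (b , o′) ∷ rest) =
  (b <ᵇ a) ∧ (not o ∨ (suc (suc b) ≤ᵇ a)) ∧ isStrictOP ((b , o′) ∷ rest)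

size : List Part → ℕ
size [] = 0
size ((a , _) ∷ xs) = a + size xs

numOver : List Part → ℕ
numOver [] = 0
numOver ((_ , o) ∷ xs) = (if o then 1 else 0) + numOver xs

overAtLeast2 : List Part → Bool
overAtLeast2 [] = true
overAtLeast2 ((a , o) ∷ xs) = (not o ∨ (2 ≤ᵇ a)) ∧ overAtLeast2 xs

-- Schmidt k-weight: λ₁ + λ_{k+1} + λ_{2k+1} + …
-- (counter c = number of parts still to skip before the next counted one)
schmidtGo : ℕ → ℕ → List Part → ℕ
schmidtGo k c [] = 0
schmidtGo k zero ((a , _) ∷ xs) = a + schmidtGo k (k ∸ 1) xs
schmidtGo k (suc c) (_ ∷ xs) = schmidtGo k c xs

schmidtWeight : ℕ → List Part → ℕ
schmidtWeight k λs = schmidtGo k 0 λs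

-- Tuples (α¹,…,αᵏ); the component with 1-based index j must satisfy:
-- strict overpartition, length t if j ≤ r else t-1, and if j ≠ r every overlined part ≥ 2.
componentOK : (t r j : ℕ) → List Part → Bool
componentOK t r j α =
  isStrictOP α ∧ (length α ≡ᵇ (if j ≤ᵇ r then t else t ∸ 1)) ∧ ((j ≡ᵇ r) ∨ overAtLeast2 α)

tupleOKFrom : (t r j : ℕ) → {m : ℕ} → Vec (List Part) m → Bool
tupleOKFrom t r j [] = true
tupleOKFrom t r j (α ∷ αs) = componentOK t r j α ∧ tupleOKFrom t r (suc j) αs

tupleSize : {m : ℕ} → Vec (List Part) m → ℕ
tupleSize [] = 0
tupleSize (α ∷ αs) = size α + tupleSize αs

tupleOver : {m : ℕ} → Vec (List Part) m → ℕ
tupleOver [] = 0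
tupleOver (α ∷ αs) = numOver α + tupleOver αs

pOK : (n k t r s : ℕ) → Vec (List Part) k → Bool
pOK n k t r s α =
  tupleOKFrom t r 1 α ∧ (tupleSize α ≡ᵇ n) ∧ (tupleOver α ≡ᵇ s)

PSet : (n k t r s : ℕ) → Set
PSet n k t r s = Σ (Vec (List Part) k) (λ α → T (pOK n k t r s α))

qOK : (n k t r s : ℕ) → List Part → Bool
qOK n k t r s λs =
  isStrictOP λs ∧ (schmidtWeight k λs ≡ᵇ n)
  ∧ (length λs ≡ᵇ ((t ∸ 1) Data.Nat.* k + r)) ∧ (numOver λs ≡ᵇ s)

QSet : (n k t r s : ℕ) → Set
QSet n k t r s = Σ (List Part) (λ λs → T (qOK n k t r s λs))

-- A strict overpartition λ₁ > ⋯ > λₗ is determined by its gaps λᵢ − λᵢ₊₁ (with λₗ₊₁ = 0), each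
-- carrying the overline of λᵢ: strictness says that every gap is positive and that an overlined
-- gap other than the last one is at least 2, and an overlined last part is at least 2 iff its gap is.
-- Write the gap sequence of a Schmidt k-overpartition with (t − 1)k + r parts in rows of length k
-- and read off the k columns: columns 1, …, r get t gaps and the others t − 1, and the last gap,
-- the only one that may be an overlined 1, is the last gap of column r. This is a bijection onto the
-- gap sequences of the tuples counted by p̄(n, k, t, r, s). A gap in row i contributes i times to
-- λ₁ + λₖ₊₁ + λ₂ₖ₊₁ + ⋯, and also i times to the size of the component in whose column it lies
-- (once to each of its first i parts); overlines are simply carried along.
module Submission where

open import Defs

open import Algebra.Bundles using (CommutativeMonoid)
open import Data.Bool using (Bool; true; false; _∧_; _∨_; not; if_then_else_; T)
open import Data.Bool.ListAction using (all)
open import Data.Bool.Properties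
  using (if-float; T-irrelevant; T-∧; ∧-assoc; ∧-identityʳ; ∧-zeroʳ; ∧-commutativeMonoid)
open import Data.List using (List; []; _∷_; length; take; drop; _++_)
import Data.List as List
open import Data.List.Properties
  using (map-++; length-++; length-take; length-drop; take++drop≡id; drop-all)
open import Data.Nat using (ℕ; zero; suc; _+_; _*_; _∸_; _≤_; _<_; z≤n; s≤s; _≤ᵇ_; _<ᵇ_; _≡ᵇ_; _≤?_)
open import Data.Nat.ListAction using (sum)
open import Data.Nat.ListAction.Properties using (sum-++)
open import Data.Nat.Properties
  using ( ≤ᵇ-reflects-≤; <ᵇ-reflects-<; <ᵇ⇒<; <⇒<ᵇ; ≡ᵇ⇒≡; ≡⇒≡ᵇ
        ; <⇒≱; <⇒≤; ≰⇒>; >⇒≢; <⇒≢; ≤-reflexive; ≤-trans; m<n⇒m<1+n; m<m+n; m≤n+m; m≤m+n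
        ; +-monoˡ-<; +-cancelʳ-<; +-identityʳ; +-suc; +-assoc; +-comm; +-commutativeSemigroup
        ; suc-injective; m∸n+n≡m; m+n∸n≡m; m+n∸m≡n; +-∸-assoc; m≤n⇒m∸n≡0; m≤n⇒m⊓n≡m )
open import Data.Product using (_×_; _,_; proj₁; proj₂; Σ; Σ-syntax)
open import Data.Vec using (Vec; []; _∷_; replicate; map)
import Data.Vec as Vec
open import Data.Vec.Properties using (∷-injective; map-replicate)
open import Function using (_∘′_)
open import Function.Bundles using (_↔_; mk↔ₛ′; Equivalence)
open import Function.Properties.Inverse using (↔-sym; ↔-trans)
open import Relation.Binary.PropositionalEquality
open import Relation.Nullary using (yes; no)
open import Relation.Nullary.Reflects using (Reflects; ofʸ; ofⁿ; det; fromEquivalence)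

open import Algebra.Properties.CommutativeSemigroup (CommutativeMonoid.commutativeSemigroup ∧-commutativeMonoid)
  using () renaming (interchange to ∧-interchange; x∙yz≈y∙xz to ∧-leftComm)
open import Algebra.Properties.CommutativeSemigroup +-commutativeSemigroup
  using () renaming (interchange to +-interchange)

private variable
  A : Set
  m : ℕ

Σ-T-≡ : {P : A → Bool} {a a′ : A} {p : T (P a)} {p′ : T (P a′)} →
  a ≡ a′ → _≡_ {A = Σ A (λ x → T (P x))} (a , p) (a′ , p′)
Σ-T-≡ refl = cong (_ ,_) (T-irrelevant _ _)

Σ-T-↔ : {A B : Set} {P : A → Bool} {Q : B → Bool} (f : A → B) (g : B → A) →
  (∀ {a} → T (P a) → T (Q (f a))) → (∀ {b} → T (Q b) → T (P (g b))) →
  (∀ {a} → T (P a) → g (f a) ≡ a) → (∀ {b} → T (Q b) → f (g b) ≡ b) →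
  Σ A (λ a → T (P a)) ↔ Σ B (λ b → T (Q b))
Σ-T-↔ f g P⇒Qf Q⇒Pg gf fg = mk↔ₛ′
  (λ (a , p) → f a , P⇒Qf p) (λ (b , q) → g b , Q⇒Pg q)
  (λ (b , q) → Σ-T-≡ (fg q)) (λ (a , p) → Σ-T-≡ (gf p))

Σ-T-section-↔ : {A B : Set} {P : B → Bool} (f : A → B) (g : B → A) →
  (∀ a → g (f a) ≡ a) → (∀ {b} → T (P b) → f (g b) ≡ b) →
  Σ A (λ a → T (P (f a))) ↔ Σ B (λ b → T (P b))
Σ-T-section-↔ {P = P} f g gf fg =
  Σ-T-↔ f g (λ p → p) (λ q → subst (T ∘′ P) (sym (fg q)) q) (λ _ → gf _) fg

≤ᵇ-true : ∀ {m n} → m ≤ n → (m ≤ᵇ n) ≡ true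
≤ᵇ-true {m} {n} m≤n = det (≤ᵇ-reflects-≤ m n) (ofʸ m≤n)

≤ᵇ-false : ∀ {m n} → n < m → (m ≤ᵇ n) ≡ false
≤ᵇ-false {m} {n} n<m = det (≤ᵇ-reflects-≤ m n) (ofⁿ (<⇒≱ n<m))

≡ᵇ-reflects-≡ : ∀ m n → Reflects (m ≡ n) (m ≡ᵇ n)
≡ᵇ-reflects-≡ m n = fromEquivalence (≡ᵇ⇒≡ m n) (≡⇒≡ᵇ m n)

≡ᵇ-true : ∀ {m n} → m ≡ n → (m ≡ᵇ n) ≡ true
≡ᵇ-true {m} {n} m≡n = det (≡ᵇ-reflects-≡ m n) (ofʸ m≡n)

≡ᵇ-false : ∀ {m n} → m ≢ n → (m ≡ᵇ n) ≡ false
≡ᵇ-false {m} {n} m≢n = det (≡ᵇ-reflects-≡ m n) (ofⁿ m≢n)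

<ᵇ-cancelʳ : ∀ a b m → (a + m <ᵇ b + m) ≡ (a <ᵇ b)
<ᵇ-cancelʳ a b m = det (<ᵇ-reflects-< (a + m) (b + m))
  (fromEquivalence (+-monoˡ-< m ∘′ <ᵇ⇒< a b) (<⇒<ᵇ ∘′ +-cancelʳ-< m a b))

T-∧⁻ : ∀ x {y} → T (x ∧ y) → T x × T y
T-∧⁻ x = Equivalence.to (T-∧ {x})

sumBy : (A → ℕ) → List A → ℕ
sumBy φ xs = sum (List.map φ xs)

sumBy-++ : ∀ (φ : A → ℕ) B R → sumBy φ (B ++ R) ≡ sumBy φ B + sumBy φ R
sumBy-++ φ B R = trans (cong sum (map-++ φ B R)) (sum-++ (List.map φ B) (List.map φ R))

prependRow : List A → Vec (List A) m → Vec (List A) m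
prependRow [] V = V
prependRow (x ∷ xs) [] = []
prependRow (x ∷ xs) (c ∷ V) = (x ∷ c) ∷ prependRow xs V

firstRow : Vec (List A) m → List A
firstRow [] = []
firstRow ([] ∷ V) = firstRow V
firstRow ((x ∷ _) ∷ V) = x ∷ firstRow V

firstRow-prependRow : ∀ (B : List A) (V : Vec (List A) m) → length B ≡ m →
  firstRow (prependRow B V) ≡ B
firstRow-prependRow [] [] _ = refl
firstRow-prependRow (x ∷ B) (c ∷ V) eq = cong (x ∷_) (firstRow-prependRow B V (suc-injective eq))

tails-prependRow : ∀ (B : List A) (V : Vec (List A) m) → length B ≡ m →
  map (drop 1) (prependRow B V) ≡ V
tails-prependRow [] [] _ = refl
tails-prependRow (x ∷ B) (c ∷ V) eq = cong (c ∷_) (tails-prependRow B V (suc-injective eq))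

firstRow-replicate : ∀ m → firstRow (replicate m ([] {A = A})) ≡ []
firstRow-replicate zero = refl
firstRow-replicate (suc m) = firstRow-replicate m

firstRow-prependRow-replicate : ∀ m (B : List A) → length B ≤ m →
  firstRow (prependRow B (replicate m [])) ≡ B
firstRow-prependRow-replicate m [] _ = firstRow-replicate m
firstRow-prependRow-replicate (suc m) (x ∷ B) (s≤s B≤m) =
  cong (x ∷_) (firstRow-prependRow-replicate m B B≤m)

tails-prependRow-replicate : ∀ m (B : List A) →
  map (drop 1) (prependRow B (replicate m [])) ≡ replicate m []
tails-prependRow-replicate m [] = map-replicate (drop 1) [] m
tails-prependRow-replicate zero (x ∷ B) = refl
tails-prependRow-replicate (suc m) (x ∷ B) = cong ([] ∷_) (tails-prependRow-replicate m B)

prependRow-surjective : ∀ (C : Vec (List A) m) ls → map length C ≡ map suc ls →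
  Σ[ B ∈ List A ] Σ[ V ∈ Vec (List A) m ] length B ≡ m × map length V ≡ ls × prependRow B V ≡ C
prependRow-surjective [] [] _ = [] , [] , refl , refl , refl
prependRow-surjective ((x ∷ c) ∷ C) (l ∷ ls) eq
  with lc , eqC ← ∷-injective eq
  with B , V , lenB , lenV , refl ← prependRow-surjective C ls eqC
  = x ∷ B , c ∷ V , cong suc lenB , cong₂ _∷_ (suc-injective lc) lenV , refl

columnHeight : (t r j : ℕ) → ℕ
columnHeight t r j = if j ≤ᵇ r then t else t ∸ 1

columnHeight-≤ : ∀ t {r j} → j ≤ r → columnHeight t r j ≡ t
columnHeight-≤ t j≤r = cong (λ b → if b then t else t ∸ 1) (≤ᵇ-true j≤r)

columnHeight-> : ∀ t {r j} → r < j → columnHeight t r j ≡ t ∸ 1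
columnHeight-> t r<j = cong (λ b → if b then t else t ∸ 1) (≤ᵇ-false r<j)

columnHeights : (t r j : ℕ) → Vec ℕ m
columnHeights {zero} t r j = []
columnHeights {suc m} t r j = columnHeight t r j ∷ columnHeights t r (suc j)

columnHeights-suc : ∀ t r j → columnHeights {m} (suc (suc t)) r j ≡ map suc (columnHeights (suc t) r j)
columnHeights-suc {zero} t r j = refl
columnHeights-suc {suc m} t r j =
  cong₂ _∷_ (sym (if-float suc (j ≤ᵇ r))) (columnHeights-suc t r (suc j))

prependRow-replicate-surjective : ∀ {r} j (C : Vec (List A) m) → r < m + j →
  map length C ≡ columnHeights 1 r j →
  Σ[ B ∈ List A ] length B ≡ suc r ∸ j × prependRow B (replicate m []) ≡ C
prependRow-replicate-surjective {r = r} j [] r<j _ = [] , sym (m≤n⇒m∸n≡0 r<j) , refl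
prependRow-replicate-surjective {m = suc m} {r = r} j (c ∷ C) r<m+j eq
  with lc , eqC ← ∷-injective eq
  with B , lenB , refl ← prependRow-replicate-surjective (suc j) C (subst (r <_) (sym (+-suc m j)) r<m+j) eqC
  with j ≤? r | c | lc
... | yes j≤r | x ∷ [] | _ = x ∷ B , trans (cong suc lenB) (sym (+-∸-assoc 1 j≤r)) , refl
... | yes j≤r | [] | lc′ with () ← trans lc′ (columnHeight-≤ 1 j≤r)
... | yes j≤r | _ ∷ _ ∷ _ | lc′ with () ← trans lc′ (columnHeight-≤ 1 j≤r)
... | no j≰r | _ ∷ _ | lc′ with () ← trans lc′ (columnHeight-> 1 (≰⇒> j≰r))
... | no j≰r | [] | _ with [] ← B | _ ← trans lenB (m≤n⇒m∸n≡0 (<⇒≤ (≰⇒> j≰r)))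
  = [] , sym (m≤n⇒m∸n≡0 (≰⇒> j≰r)) , refl

-- The list is dealt into k columns row by row: t full rows of length k, then what is left.
columns : ∀ k → ℕ → List A → Vec (List A) k
columns k zero D = prependRow D (replicate k [])
columns k (suc t) D = prependRow (take k D) (columns k t (drop k D))

uncolumns : ℕ → Vec (List A) m → List A
uncolumns zero C = firstRow C
uncolumns (suc t) C = firstRow C ++ uncolumns t (map (drop 1) C)

length-take-drop : ∀ k t {r} (D : List A) → length D ≡ suc t * k + r →
  length (take k D) ≡ k × length (drop k D) ≡ t * k + r
length-take-drop k t {r} D lenD =
  trans (length-take k D) (m≤n⇒m⊓n≡m (subst (k ≤_) (sym lenD′) (m≤m+n k _))) ,
  trans (length-drop k D) (trans (cong (_∸ k) lenD′) (m+n∸m≡n k _))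
  where
  lenD′ = trans lenD (+-assoc k (t * k) r)

take-++ : ∀ (B R : List A) {n} → length B ≡ n → take n (B ++ R) ≡ B
take-++ [] R refl = refl
take-++ (x ∷ B) R refl = cong (x ∷_) (take-++ B R refl)

drop-++ : ∀ (B R : List A) {n} → length B ≡ n → drop n (B ++ R) ≡ R
drop-++ [] R refl = refl
drop-++ (x ∷ B) R refl = drop-++ B R refl

uncolumns-columns : ∀ k t {r} (D : List A) → r ≤ k → length D ≡ t * k + r →
  uncolumns t (columns k t D) ≡ D
uncolumns-columns k zero D r≤k lenD = firstRow-prependRow-replicate k D (subst (_≤ k) (sym lenD) r≤k)
uncolumns-columns k (suc t) D r≤k lenD with lenB , lenR ← length-take-drop k t D lenD = begin
  firstRow (prependRow B V) ++ uncolumns t (map (drop 1) (prependRow B V))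
    ≡⟨ cong₂ (λ B′ V′ → B′ ++ uncolumns t V′)
             (firstRow-prependRow B V lenB) (tails-prependRow B V lenB) ⟩
  B ++ uncolumns t (columns k t R) ≡⟨ cong (B ++_) (uncolumns-columns k t R r≤k lenR) ⟩
  B ++ R                           ≡⟨ take++drop≡id k D ⟩
  D                                ∎
  where
  open ≡-Reasoning
  B = take k D
  R = drop k D
  V = columns k t R

columns-uncolumns : ∀ k t {r} (C : Vec (List A) k) → r ≤ k →
  map length C ≡ columnHeights (suc t) r 1 →
  length (uncolumns t C) ≡ t * k + r × columns k t (uncolumns t C) ≡ C
columns-uncolumns k zero {r} C r≤k shape
  with B , lenB , refl ← prependRow-replicate-surjective 1 C (subst (r <_) (+-comm 1 k) (s≤s r≤k)) shape
  rewrite firstRow-prependRow-replicate k B (subst (_≤ k) (sym lenB) r≤k) = lenB , refl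
columns-uncolumns k (suc t) {r} C r≤k shape
  with B , V , lenB , lenV , refl ← prependRow-surjective C _ (trans shape (columnHeights-suc t r 1))
  rewrite firstRow-prependRow B V lenB | tails-prependRow B V lenB
  with lenR , columnsR ← columns-uncolumns k t V r≤k lenV =
  trans (length-++ B) (trans (cong₂ _+_ lenB lenR) (sym (+-assoc k (t * k) r))) ,
  trans (cong₂ (λ B′ R′ → prependRow B′ (columns k t R′)) (take-++ B _ lenB) (drop-++ B _ lenB))
        (cong (prependRow B) columnsR)

columnSum : (A → ℕ) → Vec (List A) m → ℕ
columnSum φ C = Vec.sum (map (sumBy φ) C)

columnSum-replicate : ∀ (φ : A → ℕ) m → columnSum φ (replicate m []) ≡ 0
columnSum-replicate φ zero = refl
columnSum-replicate φ (suc m) = columnSum-replicate φ m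

columnSum-prependRow : ∀ (φ : A → ℕ) B (V : Vec (List A) m) → length B ≤ m →
  columnSum φ (prependRow B V) ≡ sumBy φ B + columnSum φ V
columnSum-prependRow φ [] V _ = refl
columnSum-prependRow φ (x ∷ B) (c ∷ V) (s≤s B≤m) =
  trans (cong (sumBy φ (x ∷ c) +_) (columnSum-prependRow φ B V B≤m))
        (+-interchange (φ x) (sumBy φ c) (sumBy φ B) (columnSum φ V))

columnSum-columns : ∀ (φ : A → ℕ) k t {r} D → r ≤ k → length D ≡ t * k + r →
  columnSum φ (columns k t D) ≡ sumBy φ D
columnSum-columns φ k zero D r≤k lenD = begin
  columnSum φ (prependRow D (replicate k []))
    ≡⟨ columnSum-prependRow φ D _ (subst (_≤ k) (sym lenD) r≤k) ⟩
  sumBy φ D + columnSum φ (replicate k []) ≡⟨ cong (sumBy φ D +_) (columnSum-replicate φ k) ⟩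
  sumBy φ D + 0                            ≡⟨ +-identityʳ _ ⟩
  sumBy φ D                                ∎
  where open ≡-Reasoning
columnSum-columns φ k (suc t) D r≤k lenD with lenB , lenR ← length-take-drop k t D lenD = begin
  columnSum φ (prependRow (take k D) (columns k t (drop k D)))
    ≡⟨ columnSum-prependRow φ (take k D) _ (≤-reflexive lenB) ⟩
  sumBy φ (take k D) + columnSum φ (columns k t (drop k D))
    ≡⟨ cong (sumBy φ (take k D) +_) (columnSum-columns φ k t (drop k D) r≤k lenR) ⟩
  sumBy φ (take k D) + sumBy φ (drop k D) ≡⟨ sumBy-++ φ (take k D) (drop k D) ⟨
  sumBy φ (take k D ++ drop k D)          ≡⟨ cong (sumBy φ) (take++drop≡id k D) ⟩
  sumBy φ D                               ∎
  where open ≡-Reasoning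

sumGaps : List Part → ℕ
sumGaps = sumBy proj₁

overlineCount : Part → ℕ
overlineCount (_ , o) = if o then 1 else 0

fromGaps : List Part → List Part
fromGaps [] = []
fromGaps ((d , o) ∷ ds) = (d + sumGaps ds , o) ∷ fromGaps ds

leading : List Part → ℕ
leading [] = 0
leading ((a , _) ∷ _) = a

toGaps : List Part → List Part
toGaps [] = []
toGaps ((a , o) ∷ xs) = (a ∸ leading xs , o) ∷ toGaps xs

goodGap : Part → Bool
goodGap (d , o) = (1 ≤ᵇ d) ∧ (not o ∨ (2 ≤ᵇ d))

validGaps : List Part → Bool
validGaps [] = true
validGaps ((d , _) ∷ []) = 1 ≤ᵇ d
validGaps (x ∷ y ∷ ys) = goodGap x ∧ validGaps (y ∷ ys)

leading-fromGaps : ∀ ds → leading (fromGaps ds) ≡ sumGaps ds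
leading-fromGaps [] = refl
leading-fromGaps (_ ∷ _) = refl

toGaps-fromGaps : ∀ ds → toGaps (fromGaps ds) ≡ ds
toGaps-fromGaps [] = refl
toGaps-fromGaps ((d , o) ∷ ds) = cong₂ (λ a rest → (a , o) ∷ rest)
  (trans (cong (d + sumGaps ds ∸_) (leading-fromGaps ds)) (m+n∸n≡m d (sumGaps ds)))
  (toGaps-fromGaps ds)

isStrictOP-tail : ∀ x xs → T (isStrictOP (x ∷ xs)) → T (isStrictOP xs)
isStrictOP-tail x [] _ = _
isStrictOP-tail (a , o) ((b , _) ∷ _) strict =
  proj₂ (T-∧⁻ (not o ∨ (suc (suc b) ≤ᵇ a)) (proj₂ (T-∧⁻ (b <ᵇ a) strict)))

leading-≤ : ∀ a o xs → T (isStrictOP ((a , o) ∷ xs)) → leading xs ≤ a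
leading-≤ a o [] _ = z≤n
leading-≤ a o ((b , _) ∷ _) strict = <⇒≤ (<ᵇ⇒< b a (proj₁ (T-∧⁻ (b <ᵇ a) strict)))

fromGaps-toGaps : ∀ xs → T (isStrictOP xs) → fromGaps (toGaps xs) ≡ xs
fromGaps-toGaps [] _ = refl
fromGaps-toGaps ((a , o) ∷ xs) strict = cong₂ (λ a rest → (a , o) ∷ rest) head-value tail-values
  where
  tail-values : fromGaps (toGaps xs) ≡ xs
  tail-values = fromGaps-toGaps xs (isStrictOP-tail _ xs strict)
  head-value : a ∸ leading xs + sumGaps (toGaps xs) ≡ a
  head-value = begin
    a ∸ leading xs + sumGaps (toGaps xs)
      ≡⟨ cong (a ∸ leading xs +_) (leading-fromGaps (toGaps xs)) ⟨
    a ∸ leading xs + leading (fromGaps (toGaps xs))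
      ≡⟨ cong (λ ys → a ∸ leading xs + leading ys) tail-values ⟩
    a ∸ leading xs + leading xs
      ≡⟨ m∸n+n≡m (leading-≤ a o xs strict) ⟩
    a ∎
    where open ≡-Reasoning

length-fromGaps : ∀ ds → length (fromGaps ds) ≡ length ds
length-fromGaps [] = refl
length-fromGaps (_ ∷ ds) = cong suc (length-fromGaps ds)

numOver-fromGaps : ∀ ds → numOver (fromGaps ds) ≡ sumBy overlineCount ds
numOver-fromGaps [] = refl
numOver-fromGaps ((_ , o) ∷ ds) = cong ((if o then 1 else 0) +_) (numOver-fromGaps ds)

isStrictOP-fromGaps : ∀ ds → isStrictOP (fromGaps ds) ≡ validGaps ds
isStrictOP-fromGaps [] = refl
isStrictOP-fromGaps ((d , o) ∷ []) = cong (1 ≤ᵇ_) (+-identityʳ d)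
isStrictOP-fromGaps ((d , o) ∷ y ∷ ys) = begin
  (S <ᵇ d + S) ∧ ((not o ∨ (suc S <ᵇ d + S)) ∧ isStrictOP (fromGaps (y ∷ ys)))
    ≡⟨ cong₂ (λ p q → p ∧ ((not o ∨ q) ∧ isStrictOP (fromGaps (y ∷ ys))))
             (<ᵇ-cancelʳ 0 d S) (<ᵇ-cancelʳ 1 d S) ⟩
  (1 ≤ᵇ d) ∧ ((not o ∨ (2 ≤ᵇ d)) ∧ isStrictOP (fromGaps (y ∷ ys)))
    ≡⟨ ∧-assoc (1 ≤ᵇ d) (not o ∨ (2 ≤ᵇ d)) _ ⟨
  goodGap (d , o) ∧ isStrictOP (fromGaps (y ∷ ys))
    ≡⟨ cong (goodGap (d , o) ∧_) (isStrictOP-fromGaps (y ∷ ys)) ⟩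
  goodGap (d , o) ∧ validGaps (y ∷ ys) ∎
  where
  S = sumGaps (y ∷ ys)
  open ≡-Reasoning

goodGap-absorbs-+ : ∀ d o m → goodGap (d , o) ∧ (not o ∨ (2 ≤ᵇ d + m)) ≡ goodGap (d , o)
goodGap-absorbs-+ zero o m = refl
goodGap-absorbs-+ (suc zero) false m = refl
goodGap-absorbs-+ (suc zero) true m = refl
goodGap-absorbs-+ (suc (suc d)) false m = refl
goodGap-absorbs-+ (suc (suc d)) true m = refl

overAtLeast2-fromGaps : ∀ ds → validGaps ds ∧ overAtLeast2 (fromGaps ds) ≡ all goodGap ds
overAtLeast2-fromGaps [] = refl
overAtLeast2-fromGaps ((d , o) ∷ []) rewrite +-identityʳ d =
  sym (∧-assoc (1 ≤ᵇ d) (not o ∨ (2 ≤ᵇ d)) true)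
overAtLeast2-fromGaps ((d , o) ∷ ds@(_ ∷ _)) = begin
  (goodGap (d , o) ∧ validGaps ds) ∧ ((not o ∨ (2 ≤ᵇ d + sumGaps ds)) ∧ overAtLeast2 (fromGaps ds))
    ≡⟨ ∧-interchange (goodGap (d , o)) (validGaps ds) _ _ ⟩
  (goodGap (d , o) ∧ (not o ∨ (2 ≤ᵇ d + sumGaps ds))) ∧ (validGaps ds ∧ overAtLeast2 (fromGaps ds))
    ≡⟨ cong₂ _∧_ (goodGap-absorbs-+ d o _) (overAtLeast2-fromGaps ds) ⟩
  goodGap (d , o) ∧ all goodGap ds ∎
  where open ≡-Reasoning

validGaps-++ : ∀ B R → R ≢ [] → validGaps (B ++ R) ≡ all goodGap B ∧ validGaps R
validGaps-++ [] R _ = refl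
validGaps-++ (x ∷ []) [] R≢[] with () ← R≢[] refl
validGaps-++ (x ∷ []) (y ∷ ys) _ = cong (_∧ validGaps (y ∷ ys)) (sym (∧-identityʳ (goodGap x)))
validGaps-++ (x ∷ z ∷ B) R R≢[] =
  trans (cong (goodGap x ∧_) (validGaps-++ (z ∷ B) R R≢[])) (sym (∧-assoc (goodGap x) _ _))

size-fromGaps : ∀ ds → size (fromGaps ds) ≡ sumGaps ds + size (fromGaps (drop 1 ds))
size-fromGaps [] = refl
size-fromGaps (_ ∷ _) = refl

drop-fromGaps : ∀ n ds → drop n (fromGaps ds) ≡ fromGaps (drop n ds)
drop-fromGaps zero ds = refl
drop-fromGaps (suc n) [] = refl
drop-fromGaps (suc n) (_ ∷ ds) = drop-fromGaps n ds

schmidtGo-drop : ∀ k c xs → schmidtGo k c xs ≡ schmidtWeight k (drop c xs)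
schmidtGo-drop k zero xs = refl
schmidtGo-drop k (suc c) [] = refl
schmidtGo-drop k (suc c) (_ ∷ xs) = schmidtGo-drop k c xs

schmidtWeight-fromGaps : ∀ k ds →
  schmidtWeight (suc k) (fromGaps ds) ≡ sumGaps ds + schmidtWeight (suc k) (fromGaps (drop (suc k) ds))
schmidtWeight-fromGaps k [] = refl
schmidtWeight-fromGaps k ((d , _) ∷ ds) =
  cong (d + sumGaps ds +_)
       (trans (schmidtGo-drop (suc k) k (fromGaps ds)) (cong (schmidtWeight (suc k)) (drop-fromGaps k ds)))

tupleSize-fromGaps : ∀ (C : Vec (List Part) m) →
  tupleSize (map fromGaps C) ≡ columnSum proj₁ C + tupleSize (map fromGaps (map (drop 1) C))
tupleSize-fromGaps [] = refl
tupleSize-fromGaps (c ∷ C) =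
  trans (cong₂ _+_ (size-fromGaps c) (tupleSize-fromGaps C))
        (+-interchange (sumGaps c) _ (columnSum proj₁ C) _)

tupleSize-replicate : ∀ m → tupleSize (map fromGaps (replicate m [])) ≡ 0
tupleSize-replicate zero = refl
tupleSize-replicate (suc m) = tupleSize-replicate m

tupleSize-columns : ∀ k t {r} D → r ≤ suc k → length D ≡ t * suc k + r →
  tupleSize (map fromGaps (columns (suc k) t D)) ≡ schmidtWeight (suc k) (fromGaps D)
tupleSize-columns k t {r} D r≤k lenD = begin
  tupleSize (map fromGaps (columns (suc k) t D))
    ≡⟨ tupleSize-fromGaps (columns (suc k) t D) ⟩
  columnSum proj₁ (columns (suc k) t D) + tupleSize (map fromGaps (map (drop 1) (columns (suc k) t D)))
    ≡⟨ cong₂ _+_ (columnSum-columns proj₁ (suc k) t D r≤k lenD) (lower-rows t lenD) ⟩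
  sumGaps D + schmidtWeight (suc k) (fromGaps (drop (suc k) D))
    ≡⟨ schmidtWeight-fromGaps k D ⟨
  schmidtWeight (suc k) (fromGaps D) ∎
  where
  open ≡-Reasoning
  lower-rows : ∀ t {D} → length D ≡ t * suc k + r →
    tupleSize (map fromGaps (map (drop 1) (columns (suc k) t D))) ≡
    schmidtWeight (suc k) (fromGaps (drop (suc k) D))
  lower-rows zero {D} lenD = begin
    tupleSize (map fromGaps (map (drop 1) (prependRow D (replicate (suc k) []))))
      ≡⟨ cong (tupleSize ∘′ map fromGaps) (tails-prependRow-replicate (suc k) D) ⟩
    tupleSize (map fromGaps (replicate (suc k) []))
      ≡⟨ tupleSize-replicate (suc k) ⟩
    0
      ≡⟨ cong (schmidtWeight (suc k) ∘′ fromGaps) (drop-all (suc k) D (subst (_≤ suc k) (sym lenD) r≤k)) ⟨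
    schmidtWeight (suc k) (fromGaps (drop (suc k) D)) ∎
  lower-rows (suc t) {D} lenD with lenB , lenR ← length-take-drop (suc k) t D lenD =
    trans (cong (tupleSize ∘′ map fromGaps) (tails-prependRow (take (suc k) D) _ lenB))
          (tupleSize-columns k t (drop (suc k) D) r≤k lenR)

tupleOver-fromGaps : ∀ (C : Vec (List Part) m) → tupleOver (map fromGaps C) ≡ columnSum overlineCount C
tupleOver-fromGaps [] = refl
tupleOver-fromGaps (c ∷ C) = cong₂ _+_ (numOver-fromGaps c) (tupleOver-fromGaps C)

gapColumnOK : ℕ → Bool → List Part → Bool
gapColumnOK ℓ lastMayBeWeak c =
  (length c ≡ᵇ ℓ) ∧ (if lastMayBeWeak then validGaps c else all goodGap c)

componentOK-fromGaps : ∀ t r j c →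
  componentOK t r j (fromGaps c) ≡ gapColumnOK (columnHeight t r j) (j ≡ᵇ r) c
componentOK-fromGaps t r j c = begin
  isStrictOP (fromGaps c) ∧ ((length (fromGaps c) ≡ᵇ h) ∧ ((j ≡ᵇ r) ∨ overAtLeast2 (fromGaps c)))
    ≡⟨ cong₂ (λ v l → v ∧ ((l ≡ᵇ h) ∧ ((j ≡ᵇ r) ∨ overAtLeast2 (fromGaps c))))
             (isStrictOP-fromGaps c) (length-fromGaps c) ⟩
  validGaps c ∧ ((length c ≡ᵇ h) ∧ ((j ≡ᵇ r) ∨ overAtLeast2 (fromGaps c)))
    ≡⟨ ∧-leftComm (validGaps c) (length c ≡ᵇ h) _ ⟩
  (length c ≡ᵇ h) ∧ (validGaps c ∧ ((j ≡ᵇ r) ∨ overAtLeast2 (fromGaps c)))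
    ≡⟨ cong ((length c ≡ᵇ h) ∧_) (lastGapCondition (j ≡ᵇ r)) ⟩
  gapColumnOK h (j ≡ᵇ r) c ∎
  where
  open ≡-Reasoning
  h = columnHeight t r j
  lastGapCondition : ∀ b →
    validGaps c ∧ (b ∨ overAtLeast2 (fromGaps c)) ≡ (if b then validGaps c else all goodGap c)
  lastGapCondition true = ∧-identityʳ (validGaps c)
  lastGapCondition false = overAtLeast2-fromGaps c

gapColumnOK-∷ : ∀ ℓ b x c → (T b → 1 ≤ ℓ) →
  gapColumnOK (suc ℓ) b (x ∷ c) ≡ goodGap x ∧ gapColumnOK ℓ b c
gapColumnOK-∷ ℓ false x c _ = ∧-leftComm (length c ≡ᵇ ℓ) (goodGap x) _
gapColumnOK-∷ ℓ true x (y ∷ ys) _ = ∧-leftComm (length (y ∷ ys) ≡ᵇ ℓ) (goodGap x) _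
gapColumnOK-∷ (suc ℓ) true x [] _ = sym (∧-zeroʳ (goodGap x))
gapColumnOK-∷ zero true x [] ℓ≥1 with () ← ℓ≥1 _

tupleOK-prependRow : ∀ t r j B (V : Vec (List Part) m) → length B ≡ m →
  tupleOKFrom (suc (suc t)) r j (map fromGaps (prependRow B V)) ≡
  all goodGap B ∧ tupleOKFrom (suc t) r j (map fromGaps V)
tupleOK-prependRow t r j [] [] _ = refl
tupleOK-prependRow t r j (x ∷ B) (c ∷ V) lenB =
  trans (cong₂ _∧_ column (tupleOK-prependRow t r (suc j) B V (suc-injective lenB)))
        (∧-interchange (goodGap x) (componentOK (suc t) r j (fromGaps c)) _ _)
  where
  open ≡-Reasoning
  at-r⇒positive : T (j ≡ᵇ r) → 1 ≤ columnHeight (suc t) r j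
  at-r⇒positive j≡r =
    subst (1 ≤_) (sym (columnHeight-≤ (suc t) (≤-reflexive (≡ᵇ⇒≡ j r j≡r)))) (s≤s z≤n)
  column : componentOK (suc (suc t)) r j (fromGaps (x ∷ c)) ≡
           goodGap x ∧ componentOK (suc t) r j (fromGaps c)
  column = begin
    componentOK (suc (suc t)) r j (fromGaps (x ∷ c))
      ≡⟨ componentOK-fromGaps (suc (suc t)) r j (x ∷ c) ⟩
    gapColumnOK (columnHeight (suc (suc t)) r j) (j ≡ᵇ r) (x ∷ c)
      ≡⟨ cong (λ ℓ → gapColumnOK ℓ (j ≡ᵇ r) (x ∷ c)) (if-float suc (j ≤ᵇ r)) ⟨
    gapColumnOK (suc (columnHeight (suc t) r j)) (j ≡ᵇ r) (x ∷ c)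
      ≡⟨ gapColumnOK-∷ _ (j ≡ᵇ r) x c at-r⇒positive ⟩
    goodGap x ∧ gapColumnOK (columnHeight (suc t) r j) (j ≡ᵇ r) c
      ≡⟨ cong (goodGap x ∧_) (componentOK-fromGaps (suc t) r j c) ⟨
    goodGap x ∧ componentOK (suc t) r j (fromGaps c) ∎

tupleOK-empty : ∀ r j → r < j → tupleOKFrom 1 r j (map fromGaps (replicate m [])) ≡ true
tupleOK-empty {zero} r j r<j = refl
tupleOK-empty {suc m} r j r<j =
  cong₂ _∧_ (cong₂ (λ h b → (0 ≡ᵇ h) ∧ (b ∨ true)) (columnHeight-> 1 r<j) (≡ᵇ-false (>⇒≢ r<j)))
            (tupleOK-empty {m} r (suc j) (m<n⇒m<1+n r<j))

-- The last gap of D lands in column r.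
tupleOK-prependRow-replicate : ∀ r j D → j + length D ≡ suc r → length D ≤ m →
  tupleOKFrom 1 r j (map fromGaps (prependRow D (replicate m []))) ≡ validGaps D
tupleOK-prependRow-replicate {m} r j [] eq _ =
  tupleOK-empty {m} r j (≤-reflexive (sym (trans (sym (+-identityʳ j)) eq)))
tupleOK-prependRow-replicate {suc m} r j (x ∷ []) eq _ = begin
  componentOK 1 r j (fromGaps (x ∷ [])) ∧ tupleOKFrom 1 r (suc j) (map fromGaps (replicate m []))
    ≡⟨ cong₂ _∧_ (componentOK-fromGaps 1 r j (x ∷ []))
                 (tupleOK-empty {m} r (suc j) (s≤s (≤-reflexive (sym j≡r)))) ⟩
  gapColumnOK (columnHeight 1 r j) (j ≡ᵇ r) (x ∷ []) ∧ true
    ≡⟨ cong₂ (λ h b → gapColumnOK h b (x ∷ []) ∧ true)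
             (columnHeight-≤ 1 (≤-reflexive j≡r)) (≡ᵇ-true j≡r) ⟩
  validGaps (x ∷ []) ∧ true ≡⟨ ∧-identityʳ _ ⟩
  validGaps (x ∷ []) ∎
  where
  open ≡-Reasoning
  j≡r : j ≡ r
  j≡r = suc-injective (trans (+-comm 1 j) eq)
tupleOK-prependRow-replicate {suc m} r j (x ∷ y ∷ ys) eq (s≤s D≤m) = begin
  componentOK 1 r j (fromGaps (x ∷ [])) ∧
  tupleOKFrom 1 r (suc j) (map fromGaps (prependRow (y ∷ ys) (replicate m [])))
    ≡⟨ cong₂ _∧_ (componentOK-fromGaps 1 r j (x ∷ []))
                 (tupleOK-prependRow-replicate r (suc j) (y ∷ ys) eq′ D≤m) ⟩
  gapColumnOK (columnHeight 1 r j) (j ≡ᵇ r) (x ∷ []) ∧ validGaps (y ∷ ys)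
    ≡⟨ cong₂ (λ h b → gapColumnOK h b (x ∷ []) ∧ validGaps (y ∷ ys))
             (columnHeight-≤ 1 (<⇒≤ j<r)) (≡ᵇ-false (<⇒≢ j<r)) ⟩
  (goodGap x ∧ true) ∧ validGaps (y ∷ ys) ≡⟨ cong (_∧ validGaps (y ∷ ys)) (∧-identityʳ _) ⟩
  goodGap x ∧ validGaps (y ∷ ys) ∎
  where
  open ≡-Reasoning
  eq′ : suc j + length (y ∷ ys) ≡ suc r
  eq′ = trans (sym (+-suc j _)) eq
  j<r : j < r
  j<r = subst (j <_) (suc-injective eq′) (m<m+n j (s≤s z≤n))

tupleOK-columns : ∀ k t {r} D → 1 ≤ r → r ≤ k → length D ≡ t * k + r →
  tupleOKFrom (suc t) r 1 (map fromGaps (columns k t D)) ≡ validGaps D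
tupleOK-columns k zero {r} D _ r≤k lenD =
  tupleOK-prependRow-replicate r 1 D (cong suc lenD) (subst (_≤ k) (sym lenD) r≤k)
tupleOK-columns k (suc t) {r} D 1≤r r≤k lenD with lenB , lenR ← length-take-drop k t D lenD = begin
  tupleOKFrom (suc (suc t)) r 1 (map fromGaps (prependRow B (columns k t R)))
    ≡⟨ tupleOK-prependRow t r 1 B (columns k t R) lenB ⟩
  all goodGap B ∧ tupleOKFrom (suc t) r 1 (map fromGaps (columns k t R))
    ≡⟨ cong (all goodGap B ∧_) (tupleOK-columns k t R 1≤r r≤k lenR) ⟩
  all goodGap B ∧ validGaps R ≡⟨ validGaps-++ B R R≢[] ⟨
  validGaps (B ++ R)          ≡⟨ cong validGaps (take++drop≡id k D) ⟩
  validGaps D                 ∎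
  where
  open ≡-Reasoning
  B = take k D
  R = drop k D
  R≢[] : R ≢ []
  R≢[] R≡[] with () ← ≤-trans 1≤r (subst (r ≤_) (trans (sym lenR) (cong length R≡[])) (m≤n+m r (t * k)))

pOK-columns : ∀ n k t r s D → 1 ≤ r → r ≤ suc k → length D ≡ t * suc k + r →
  pOK n (suc k) (suc t) r s (map fromGaps (columns (suc k) t D)) ≡ qOK n (suc k) (suc t) r s (fromGaps D)
pOK-columns n k t r s D 1≤r r≤k lenD = begin
  tupleOKFrom (suc t) r 1 C′ ∧ ((tupleSize C′ ≡ᵇ n) ∧ (tupleOver C′ ≡ᵇ s))
    ≡⟨ cong₂ _∧_ (trans (tupleOK-columns (suc k) t D 1≤r r≤k lenD) (sym (isStrictOP-fromGaps D)))
                 (cong₂ (λ w o → (w ≡ᵇ n) ∧ (o ≡ᵇ s)) (tupleSize-columns k t D r≤k lenD) overlines) ⟩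
  isStrictOP λs ∧ ((schmidtWeight (suc k) λs ≡ᵇ n) ∧ (numOver λs ≡ᵇ s))
    ≡⟨ cong (λ b → isStrictOP λs ∧ ((schmidtWeight (suc k) λs ≡ᵇ n) ∧ (b ∧ (numOver λs ≡ᵇ s))))
            (≡ᵇ-true (trans (length-fromGaps D) lenD)) ⟨
  qOK n (suc k) (suc t) r s λs ∎
  where
  open ≡-Reasoning
  C′ = map fromGaps (columns (suc k) t D)
  λs = fromGaps D
  overlines : tupleOver C′ ≡ numOver λs
  overlines = begin
    tupleOver C′                                  ≡⟨ tupleOver-fromGaps (columns (suc k) t D) ⟩
    columnSum overlineCount (columns (suc k) t D) ≡⟨ columnSum-columns overlineCount (suc k) t D r≤k lenD ⟩
    sumBy overlineCount D                         ≡⟨ numOver-fromGaps D ⟨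
    numOver λs                                    ∎

tupleOK⇒columnHeights : ∀ t r j (C : Vec (List Part) m) → T (tupleOKFrom t r j (map fromGaps C)) →
  map length C ≡ columnHeights t r j
tupleOK⇒columnHeights t r j [] _ = refl
tupleOK⇒columnHeights t r j (c ∷ C) ok = cong₂ _∷_
  (≡ᵇ⇒≡ (length c) _ (proj₁ (T-∧⁻ (length c ≡ᵇ columnHeight t r j) column)))
  (tupleOK⇒columnHeights t r (suc j) C (proj₂ (T-∧⁻ (componentOK t r j (fromGaps c)) ok)))
  where
  column : T (gapColumnOK (columnHeight t r j) (j ≡ᵇ r) c)
  column = subst T (componentOK-fromGaps t r j c) (proj₁ (T-∧⁻ (componentOK t r j (fromGaps c)) ok))

fromGaps-toGaps-tuple : ∀ t r j (α : Vec (List Part) m) → T (tupleOKFrom t r j α) →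
  map fromGaps (map toGaps α) ≡ α
fromGaps-toGaps-tuple t r j [] _ = refl
fromGaps-toGaps-tuple t r j (a ∷ α) ok = cong₂ _∷_
  (fromGaps-toGaps a (proj₁ (T-∧⁻ (isStrictOP a) (proj₁ (T-∧⁻ (componentOK t r j a) ok)))))
  (fromGaps-toGaps-tuple t r (suc j) α (proj₂ (T-∧⁻ (componentOK t r j a) ok)))

toGaps-fromGaps-tuple : ∀ (C : Vec (List Part) m) → map toGaps (map fromGaps C) ≡ C
toGaps-fromGaps-tuple [] = refl
toGaps-fromGaps-tuple (c ∷ C) = cong₂ _∷_ (toGaps-fromGaps c) (toGaps-fromGaps-tuple C)

gapTuples↔PSet : ∀ n k t r s →
  Σ (Vec (List Part) k) (λ C → T (pOK n k t r s (map fromGaps C))) ↔ PSet n k t r s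
gapTuples↔PSet n k t r s = Σ-T-section-↔ (map fromGaps) (map toGaps) toGaps-fromGaps-tuple
  (λ {α} ok → fromGaps-toGaps-tuple t r 1 α (proj₁ (T-∧⁻ (tupleOKFrom t r 1 α) ok)))

gapLists↔QSet : ∀ n k t r s → Σ (List Part) (λ D → T (qOK n k t r s (fromGaps D))) ↔ QSet n k t r s
gapLists↔QSet n k t r s = Σ-T-section-↔ fromGaps toGaps toGaps-fromGaps
  (λ {λs} ok → fromGaps-toGaps λs (proj₁ (T-∧⁻ (isStrictOP λs) ok)))

gapTuples↔gapLists : ∀ n k t r s → 1 ≤ r → r ≤ suc k →
  Σ (Vec (List Part) (suc k)) (λ C → T (pOK n (suc k) (suc t) r s (map fromGaps C))) ↔
  Σ (List Part) (λ D → T (qOK n (suc k) (suc t) r s (fromGaps D)))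
gapTuples↔gapLists n k t r s 1≤r r≤k =
  Σ-T-↔ (uncolumns t) (columns (suc k) t) tuple⇒list list⇒tuple (λ {C} ok → proj₂ (shape C ok))
    (λ {D} ok → uncolumns-columns (suc k) t D r≤k (length-of D ok))
  where
  P = pOK n (suc k) (suc t) r s
  Q = qOK n (suc k) (suc t) r s
  length-of : ∀ D → T (Q (fromGaps D)) → length D ≡ t * suc k + r
  length-of D ok = trans (sym (length-fromGaps D)) (≡ᵇ⇒≡ _ _ length-conjunct)
    where
    λs = fromGaps D
    length-conjunct : T (length λs ≡ᵇ t * suc k + r)
    length-conjunct = proj₁ (T-∧⁻ (length λs ≡ᵇ t * suc k + r)
      (proj₂ (T-∧⁻ (schmidtWeight (suc k) λs ≡ᵇ n) (proj₂ (T-∧⁻ (isStrictOP λs) ok)))))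
  shape : ∀ C → T (P (map fromGaps C)) →
    length (uncolumns t C) ≡ t * suc k + r × columns (suc k) t (uncolumns t C) ≡ C
  shape C ok = columns-uncolumns (suc k) t C r≤k
    (tupleOK⇒columnHeights (suc t) r 1 C (proj₁ (T-∧⁻ (tupleOKFrom (suc t) r 1 (map fromGaps C)) ok)))
  tuple⇒list : ∀ {C} → T (P (map fromGaps C)) → T (Q (fromGaps (uncolumns t C)))
  tuple⇒list {C} ok = subst T
    (trans (cong (P ∘′ map fromGaps) (sym (proj₂ (shape C ok))))
           (pOK-columns n k t r s _ 1≤r r≤k (proj₁ (shape C ok)))) ok
  list⇒tuple : ∀ {D} → T (Q (fromGaps D)) → T (P (map fromGaps (columns (suc k) t D)))
  list⇒tuple {D} ok = subst T (sym (pOK-columns n k t r s D 1≤r r≤k (length-of D ok))) ok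

theorem9 : (n k t r s : ℕ) → 1 ≤ n → 1 ≤ k → 1 ≤ t → 1 ≤ s → 1 ≤ r → r ≤ k →
    PSet n k t r s ↔ QSet n k t r s
theorem9 n (suc k) (suc t) r s _ (s≤s z≤n) (s≤s z≤n) _ 1≤r r≤k =
  ↔-trans (↔-sym (gapTuples↔PSet n (suc k) (suc t) r s))
    (↔-trans (gapTuples↔gapLists n k t r s 1≤r r≤k) (gapLists↔QSet n (suc k) (suc t) r s))
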